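{- Let $(L,\leq)$ be a finite lattice and $(a,b)\in\operatorname{Rel}^*(L)$. Then $\kappa(\operatorname{Tr}(a,b))=\{(x,y): (u,v) \text{ lifts on the left } (x,y) \text{ for all } (u,v)\in\operatorname{Ls}(a,b)\}=\{(x,y): (a,b) \text{ lifts on the left } (x,y)\}$.
   Context: $\operatorname{Rel}^*(L)$ is the set of pairs $a<b$ in $L$. A relation $(a,b)$ lifts on the left $(x,y)$ if whenever $a\leq x$ and $b\leq y$ we have $b\leq x$. A transfer system on $L$ is a subposet $\lhd$ of $\leq$ such that $x\lhd y$ and $w\leq y$ imply $x\wedge w\lhd w$; they form a semidistributive lattice under inclusion. $\operatorname{Tr}(a,b)$ is the smallest transfer system containing $(a,b)$ (the join-irreducibles), and $\operatorname{Ls}(a,b)$ is the smallest left saturated set (subposet of $\leq$ closed under pushouts: $x\lhd y$, $x\leq w$ imply $w\lhd y\vee w$) containing $(a,b)$. In a semidistributive lattice, $\kappa(j)$ is the meet label of the cover $j_*\lessdot j$, i.e. the unique meet-irreducible $m$ with $j\wedge m=j_*$ and $j\wedge m^*=j$. -}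

module Defs where

open import Level using (0ℓ)
open import Data.Nat using (ℕ)
open import Data.Fin using (Fin)
open import Data.Bool using (Bool; T) renaming (_∧_ to _and_)
open import Data.Product using (Σ; _×_)
open import Data.Sum using (_⊎_)
open import Data.Empty using (⊥)
open import Relation.Nullary using (¬_)
open import Relation.Binary.Core using (Rel)
open import Relation.Binary.Definitions using (Decidable)
open import Relation.Binary.PropositionalEquality using (_≡_)
open import Algebra.Core using (Op₂)
open import Relation.Binary.Lattice.Structures using (IsLattice)

record FinLattice : Set₁ where
  field
    n         : ℕ
    _≤_       : Rel (Fin n) 0ℓ
    _≤?_      : Decidable _≤_
    _⊔_       : Op₂ (Fin n)
    _⊓_       : Op₂ (Fin n)
    isLattice : IsLattice _≡_ _≤_ _⊔_ _⊓_

module _ (L : FinLattice) where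
  open FinLattice L

  Carrier : Set
  Carrier = Fin n

  BRel : Set
  BRel = Carrier → Carrier → Bool

  _∋_,_ : BRel → Carrier → Carrier → Set
  R ∋ x , y = T (R x y)

  _<L_ : Carrier → Carrier → Set
  x <L y = x ≤ y × ¬ (x ≡ y)

  LiftsLeft : Carrier → Carrier → Carrier → Carrier → Set
  LiftsLeft a b x y = a ≤ x → b ≤ y → b ≤ x

  record IsSubposet (R : BRel) : Set where
    field
      sub   : ∀ x y → R ∋ x , y → x ≤ y
      refl  : ∀ x → R ∋ x , x
      trans : ∀ x y z → R ∋ x , y → R ∋ y , z → R ∋ x , z

  record IsTransferSystem (R : BRel) : Set where
    field
      subposet : IsSubposet R
      restrict : ∀ x y w → R ∋ x , y → w ≤ y → R ∋ (x ⊓ w) , w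

  record IsLeftSaturated (R : BRel) : Set where
    field
      subposet : IsSubposet R
      pushout  : ∀ x y w → R ∋ x , y → x ≤ w → R ∋ w , (y ⊔ w)

  _⊆_ : BRel → BRel → Set
  R ⊆ S = ∀ x y → R ∋ x , y → S ∋ x , y

  _≐_ : BRel → BRel → Set
  R ≐ S = R ⊆ S × S ⊆ R

  _⊂_ : BRel → BRel → Set
  R ⊂ S = R ⊆ S × ¬ (S ⊆ R)

  -- meet in the lattice of transfer systems = intersection
  _∩_ : BRel → BRel → BRel
  (R ∩ S) x y = R x y and S x y

  IsTr : Carrier → Carrier → BRel → Set
  IsTr a b R = IsTransferSystem R × R ∋ a , b
             × (∀ S → IsTransferSystem S → S ∋ a , b → R ⊆ S)

  IsLs : Carrier → Carrier → BRel → Set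
  IsLs a b R = IsLeftSaturated R × R ∋ a , b
             × (∀ S → IsLeftSaturated S → S ∋ a , b → R ⊆ S)

  _⋖_ : BRel → BRel → Set
  R ⋖ S = IsTransferSystem R × IsTransferSystem S × R ⊂ S
        × (∀ U → IsTransferSystem U → R ⊂ U → U ⊂ S → ⊥)

  UniqueLowerCover : BRel → BRel → Set
  UniqueLowerCover J J* = J* ⋖ J × (∀ U → U ⋖ J → U ≐ J*)

  UniqueUpperCover : BRel → BRel → Set
  UniqueUpperCover M M* = M ⋖ M* × (∀ U → M ⋖ U → U ≐ M*)

  IsKappa : BRel → BRel → Set
  IsKappa J M = IsTransferSystem M
              × Σ BRel (λ J* → UniqueLowerCover J J*
                × Σ BRel (λ M* → UniqueUpperCover M M*
                  × ((J ∩ M) ≐ J*) × ((J ∩ M*) ≐ J)))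

{-# OPTIONS --safe #-}
-- Let rlp a b be the set of pairs x ≤ y against which (a , b) lifts on the left. It is a
-- transfer system without (a , b), and a transfer system U containing every (a , c) with
-- a ≤ c < b and some pair (x , y) outside rlp a b contains (a , b): restrict (x , y) to
-- (x ∧ b , b) and precede it by (a , x ∧ b). Tr(a , b) consists of identities and pairs
-- (a ∧ y , y) with y ≤ b, so its only pair outside rlp a b is (a , b), and
-- Tr(a , b) ∩ rlp a b is its unique lower cover; rlp a b together with the pairs (a , y),
-- b ≤ y, is the unique upper cover of rlp a b. Hence rlp a b is a κ(Tr(a , b)).
-- Conversely, if M is one, its lower cover condition gives Tr(a , b) ∩ rlp a b ⊆ M and
-- (a , b) ∉ M, so M ⊆ rlp a b by the argument above, and a strict inclusion would put the
-- upper cover of M, which contains (a , b), inside rlp a b. Finally, the pairs lifting on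
-- the left against a fixed (x , y) form a left saturated set, so if (a , b) lifts against
-- (x , y), so does all of Ls(a , b).
module Submission where

open import Defs using (FinLattice; Carrier; BRel; _∋_,_; _<L_; LiftsLeft; IsSubposet; IsTransferSystem; IsLeftSaturated; IsTr; IsLs; UniqueLowerCover; UniqueUpperCover; IsKappa)
open import Data.Bool using (Bool; T)
open import Data.Bool.Properties using (T-∧; T-≡)
open import Data.Empty using (⊥-elim)
open import Data.Fin using (Fin; combine; remQuot)
open import Data.Fin.Properties using (remQuot-combine; ¬∀⟶∃¬)
open import Data.Fin.Subset as Sub using (Subset)
import Data.Fin.Subset.Induction as Sub
open import Data.Fin.Subset.Properties using (_∈?_)
open import Data.Nat using (_*_)
open import Data.Product as Product using (Σ; _×_; _,_; proj₁; proj₂; uncurry)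
open import Data.Product.Function.NonDependent.Propositional using (_×-⇔_)
open import Data.Sum as Sum using (_⊎_; inj₁; inj₂; [_,_])
open import Data.Vec using (tabulate)
open import Data.Vec.Properties using (lookup∘tabulate; []=⇒lookup; lookup⇒[]=)
open import Function.Base using (_∘_; id)
open import Function.Bundles using (_⇔_; mk⇔; Equivalence)
open import Function.Construct.Composition using (_⇔-∘_)
open import Function.Construct.Identity using (⇔-id)
open import Induction.WellFounded as WF using (WellFounded; Acc; acc)
import Relation.Binary.Construct.On as On
open import Relation.Binary.Lattice.Structures using (IsLattice)
open import Relation.Binary.PropositionalEquality using (_≡_; refl; sym; trans; subst)
open import Relation.Nullary using (¬_; Dec; yes; no)
open import Relation.Nullary.Decidable using (isYes; toWitness; fromWitness; decidable-stable; T?; _×-dec_; _⊎-dec_; _→-dec_)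

module _ (L : FinLattice) where
  open FinLattice L
  open IsLattice isLattice using (antisym; x∧y≤x; x∧y≤y; ∧-greatest; x≤x∨y; y≤x∨y; ∨-least)
    renaming (refl to ≤-refl; trans to ≤-trans)

  infix 4 _⊆_ _⊂_ _≐_ _⋖_
  infixl 7 _∩_

  _⊆_ : BRel L → BRel L → Set
  _⊆_ = Defs._⊆_ L

  _⊂_ : BRel L → BRel L → Set
  _⊂_ = Defs._⊂_ L

  _≐_ : BRel L → BRel L → Set
  _≐_ = Defs._≐_ L

  _⋖_ : BRel L → BRel L → Set
  _⋖_ = Defs._⋖_ L

  _∩_ : BRel L → BRel L → BRel L
  _∩_ = Defs._∩_ L

  asSubset : BRel L → Subset (n * n)
  asSubset R = tabulate (uncurry R ∘ remQuot n)

  ∈-asSubset : ∀ R i → i Sub.∈ asSubset R ⇔ T (uncurry R (remQuot n i))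
  ∈-asSubset R i = mk⇔
    (λ i∈R → Equivalence.from T-≡ (trans (sym (lookup∘tabulate f i)) ([]=⇒lookup i∈R)))
    (λ t → lookup⇒[]= i (asSubset R) (trans (lookup∘tabulate f i) (Equivalence.to T-≡ t)))
    where
    f : Fin (n * n) → Bool
    f = uncurry R ∘ remQuot n

  ⊆⇒asSubset-⊆ : ∀ {R S} → R ⊆ S → asSubset R Sub.⊆ asSubset S
  ⊆⇒asSubset-⊆ {R} {S} R⊆S {i} =
    Equivalence.from (∈-asSubset S i) ∘ R⊆S _ _ ∘ Equivalence.to (∈-asSubset R i)

  asSubset-⊆⇒⊆ : ∀ {R S} → asSubset R Sub.⊆ asSubset S → R ⊆ S
  asSubset-⊆⇒⊆ {R} {S} R′⊆S′ x y =
    subst (λ p → T (uncurry R p) → T (uncurry S p)) (remQuot-combine x y)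
    (Equivalence.to (∈-asSubset S (combine x y)) ∘ R′⊆S′ ∘ Equivalence.from (∈-asSubset R (combine x y)))

  ⊂⇒asSubset-⊂ : ∀ {R S} → R ⊂ S → asSubset R Sub.⊂ asSubset S
  ⊂⇒asSubset-⊂ {R} {S} (R⊆S , S⊈R)
    with ¬∀⟶∃¬ (n * n) _ (λ i → (i ∈? asSubset S) →-dec (i ∈? asSubset R))
                         (λ S′⊆R′ → S⊈R (asSubset-⊆⇒⊆ (S′⊆R′ _)))
  ... | i , i∈S′⇏i∈R′ = ⊆⇒asSubset-⊆ R⊆S , i
    , decidable-stable (i ∈? asSubset S) (λ i∉S′ → i∈S′⇏i∈R′ (⊥-elim ∘ i∉S′))
    , λ i∈R′ → i∈S′⇏i∈R′ (λ _ → i∈R′)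

  ⊂-wellFounded : WellFounded _⊂_
  ⊂-wellFounded = WF.Subrelation.wellFounded ⊂⇒asSubset-⊂ (On.wellFounded asSubset Sub.⊂-wellFounded)

  ∋-∩⁺ : ∀ R S {x y} → T (R x y) → T (S x y) → T ((R ∩ S) x y)
  ∋-∩⁺ R S {x} {y} r s = Equivalence.from (T-∧ {R x y} {S x y}) (r , s)

  ∋-∩⁻ : ∀ R S {x y} → T ((R ∩ S) x y) → T (R x y) × T (S x y)
  ∋-∩⁻ R S {x} {y} = Equivalence.to (T-∧ {R x y} {S x y})

  ∩-⊆ˡ : ∀ R S → R ∩ S ⊆ R
  ∩-⊆ˡ R S _ _ = proj₁ ∘ ∋-∩⁻ R S

  module _ {R : BRel L} (tsR : IsTransferSystem L R) where
    private
      module P = IsSubposet (IsTransferSystem.subposet tsR)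

    ts-sub : ∀ {x y} → T (R x y) → x ≤ y
    ts-sub = P.sub _ _

    ts-refl : ∀ x → T (R x x)
    ts-refl = P.refl

    ts-trans : ∀ {x y z} → T (R x y) → T (R y z) → T (R x z)
    ts-trans = P.trans _ _ _

    ts-restrict : ∀ {x y} w → T (R x y) → w ≤ y → T (R (x ⊓ w) w)
    ts-restrict = IsTransferSystem.restrict tsR _ _

  ∩-isTransferSystem : ∀ {R S} → IsTransferSystem L R → IsTransferSystem L S → IsTransferSystem L (R ∩ S)
  ∩-isTransferSystem {R} {S} tsR tsS = record
    { subposet = record
      { sub   = λ _ _ rs → ts-sub tsR (proj₁ (∩⁻ rs))
      ; refl  = λ x → ∩⁺ (ts-refl tsR x) (ts-refl tsS x)
      ; trans = λ _ _ _ rs₁ rs₂ → let r₁ , s₁ = ∩⁻ rs₁ ; r₂ , s₂ = ∩⁻ rs₂ in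
          ∩⁺ (ts-trans tsR r₁ r₂) (ts-trans tsS s₁ s₂)
      }
    ; restrict = λ _ _ w rs w≤y → let r , s = ∩⁻ rs in
        ∩⁺ (ts-restrict tsR w r w≤y) (ts-restrict tsS w s w≤y)
    }
    where
    ∩⁺ : ∀ {x y} → T (R x y) → T (S x y) → T ((R ∩ S) x y)
    ∩⁺ = ∋-∩⁺ R S

    ∩⁻ : ∀ {x y} → T ((R ∩ S) x y) → T (R x y) × T (S x y)
    ∩⁻ = ∋-∩⁻ R S

  uniqueLowerCover-intro : ∀ {J K} → IsTransferSystem L J → IsTransferSystem L K → K ⊂ J
    → (∀ U → IsTransferSystem L U → U ⊂ J → U ⊆ K) → UniqueLowerCover L J K
  uniqueLowerCover-intro {J} {K} tsJ tsK K⊂J below = K⋖J , unique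
    where
    K⋖J : K ⋖ J
    K⋖J = tsK , tsJ , K⊂J , λ U tsU K⊂U U⊂J → proj₂ K⊂U (below U tsU U⊂J)

    unique : ∀ U → U ⋖ J → U ≐ K
    unique U (tsU , _ , U⊂J , nothingBetween) = U⊆K , λ x y k →
      decidable-stable (T? (U x y)) λ ¬u → nothingBetween K tsK (U⊆K , λ K⊆U → ¬u (K⊆U x y k)) K⊂J
      where
      U⊆K : U ⊆ K
      U⊆K = below U tsU U⊂J

  uniqueUpperCover-intro : ∀ {M M*} → IsTransferSystem L M → IsTransferSystem L M* → M ⊂ M*
    → (∀ U → IsTransferSystem L U → M ⊂ U → M* ⊆ U) → UniqueUpperCover L M M*
  uniqueUpperCover-intro {M} {M*} tsM tsM* M⊂M* above = M⋖M* , unique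
    where
    M⋖M* : M ⋖ M*
    M⋖M* = tsM , tsM* , M⊂M* , λ U tsU M⊂U U⊂M* → proj₂ U⊂M* (above U tsU M⊂U)

    unique : ∀ U → M ⋖ U → U ≐ M*
    unique U (_ , tsU , M⊂U , nothingBetween) = U⊆M* , M*⊆U
      where
      M*⊆U : M* ⊆ U
      M*⊆U = above U tsU M⊂U

      U⊆M* : U ⊆ M*
      U⊆M* x y u = decidable-stable (T? (M* x y)) λ ¬m* →
        nothingBetween M* tsM* M⊂M* (M*⊆U , λ U⊆M* → ¬m* (U⊆M* x y u))

  -- Finiteness is essential: in general a strict extension of M need not contain a cover of M.
  uniqueUpperCover-least : ∀ {M M*} → UniqueUpperCover L M M*
    → ∀ V → IsTransferSystem L V → M ⊂ V → M* ⊆ V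
  uniqueUpperCover-least {M} {M*} ((tsM , _) , unique) V = go V (⊂-wellFounded V)
    where
    go : ∀ V → Acc _⊂_ V → IsTransferSystem L V → M ⊂ V → M* ⊆ V
    go V (acc smaller) tsV M⊂V x y m* = decidable-stable (T? (V x y)) λ ¬v →
      ¬v (proj₂ (unique V (tsM , tsV , M⊂V , λ U tsU M⊂U U⊂V →
        ¬v (proj₁ U⊂V x y (go U (smaller U⊂V) tsU M⊂U x y m*)))) x y m*)

  liftsLeft? : ∀ u v x y → Dec (LiftsLeft L u v x y)
  liftsLeft? u v x y = (u ≤? x) →-dec ((v ≤? y) →-dec (v ≤? x))

  llp : Carrier L → Carrier L → BRel L
  llp x y u v = isYes ((u ≤? v) ×-dec liftsLeft? u v x y)

  rlp : Carrier L → Carrier L → BRel L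
  rlp a b x y = isYes ((x ≤? y) ×-dec liftsLeft? a b x y)

  -- The paper's M^*: rlp a b together with the pairs (a , y), b ≤ y; given a ≤ x,
  -- the disjunct x ≤ a says x ≡ a.
  rlp* : Carrier L → Carrier L → BRel L
  rlp* a b x y = isYes ((x ≤? y) ×-dec ((a ≤? x) →-dec ((b ≤? y) →-dec ((b ≤? x) ⊎-dec (x ≤? a)))))

  -- A transfer system containing Tr(a , b) = {(x , x)} ∪ {(a ∧ y , y) : y ≤ b}.
  idOrBelow : Carrier L → Carrier L → BRel L
  idOrBelow a b x y = isYes ((x ≤? y) ×-dec ((y ≤? x) ⊎-dec ((x ≤? a) ×-dec (y ≤? b))))

  llp-isLeftSaturated : ∀ x y → IsLeftSaturated L (llp x y)
  llp-isLeftSaturated x y = record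
    { subposet = record
      { sub   = λ _ _ → proj₁ ∘ toWitness
      ; refl  = λ _ → fromWitness (≤-refl , λ u≤x _ → u≤x)
      ; trans = λ _ _ _ l₁ l₂ → let u≤v , uv = toWitness l₁ ; v≤w , vw = toWitness l₂ in
          fromWitness (≤-trans u≤v v≤w , λ u≤x w≤y → vw (uv u≤x (≤-trans v≤w w≤y)) w≤y)
      }
    ; pushout = λ _ _ _ l u≤w → let _ , uv = toWitness l in
        fromWitness (y≤x∨y _ _ , λ w≤x v∨w≤y →
          ∨-least (uv (≤-trans u≤w w≤x) (≤-trans (x≤x∨y _ _) v∨w≤y)) w≤x)
    }

  ls-liftsLeft : ∀ {a b S} → IsLs L a b S
    → ∀ {x y} → LiftsLeft L a b x y ⇔ (∀ u v → T (S u v) → LiftsLeft L u v x y)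
  ls-liftsLeft {a} {b} {S} (lsS , ab∈S , minimal) {x} {y} = mk⇔
    (λ ab↑xy u v uv∈S → proj₂ (toWitness (minimal (llp x y) (llp-isLeftSaturated x y)
      (fromWitness (IsSubposet.sub (IsLeftSaturated.subposet lsS) a b ab∈S , ab↑xy)) u v uv∈S)))
    (λ lifts → lifts a b ab∈S)

  rlp-isTransferSystem : ∀ a b → IsTransferSystem L (rlp a b)
  rlp-isTransferSystem a b = record
    { subposet = record
      { sub   = λ _ _ → proj₁ ∘ toWitness
      ; refl  = λ _ → fromWitness (≤-refl , λ _ b≤x → b≤x)
      ; trans = λ _ _ _ m₁ m₂ → let x≤y , xy = toWitness m₁ ; y≤z , yz = toWitness m₂ in
          fromWitness (≤-trans x≤y y≤z , λ a≤x b≤z → xy a≤x (yz (≤-trans a≤x x≤y) b≤z))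
      }
    ; restrict = λ _ _ _ m w≤y → let _ , xy = toWitness m in
        fromWitness (x∧y≤y _ _ , λ a≤x∧w b≤w →
          ∧-greatest (xy (≤-trans a≤x∧w (x∧y≤x _ _)) (≤-trans b≤w w≤y)) b≤w)
    }

  ≐⇒∋⇔ : ∀ {R S x y} → R ≐ S → T (R x y) ⇔ T (S x y)
  ≐⇒∋⇔ {x = x} {y} (R⊆S , S⊆R) = mk⇔ (R⊆S x y) (S⊆R x y)

  ∋-rlp : ∀ {a b x y} → T (rlp a b x y) ⇔ (x ≤ y × LiftsLeft L a b x y)
  ∋-rlp = mk⇔ toWitness fromWitness

  x≤y⇒x∧y≡x : ∀ {x y} → x ≤ y → x ⊓ y ≡ x
  x≤y⇒x∧y≡x x≤y = antisym (x∧y≤x _ _) (∧-greatest ≤-refl x≤y)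

  module _ {a b : Carrier L} where

    ¬rlp⇒a≤x×b≤y×b≰x : ∀ {x y} → x ≤ y → ¬ T (rlp a b x y) → a ≤ x × b ≤ y × ¬ b ≤ x
    ¬rlp⇒a≤x×b≤y×b≰x {x} {y} x≤y ¬m with a ≤? x | b ≤? y | b ≤? x
    ... | no a≰x | _      | _     = ⊥-elim (¬m (fromWitness (x≤y , λ a≤x → ⊥-elim (a≰x a≤x))))
    ... | yes _  | no b≰y | _     = ⊥-elim (¬m (fromWitness (x≤y , λ _ b≤y → ⊥-elim (b≰y b≤y))))
    ... | yes _  | yes _  | yes b≤x = ⊥-elim (¬m (fromWitness (x≤y , λ _ _ → b≤x)))
    ... | yes a≤x | yes b≤y | no b≰x = a≤x , b≤y , b≰x

    b≤x⇒rlp : ∀ {x y} → x ≤ y → b ≤ x → T (rlp a b x y)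
    b≤x⇒rlp x≤y b≤x = fromWitness (x≤y , λ _ _ → b≤x)

    b≰y⇒rlp : ∀ {x y} → x ≤ y → ¬ b ≤ y → T (rlp a b x y)
    b≰y⇒rlp x≤y b≰y = fromWitness (x≤y , λ _ b≤y → ⊥-elim (b≰y b≤y))

    ∉rlp⇒∋ab : ∀ {U} → a ≤ b → IsTransferSystem L U
      → (∀ {c} → a ≤ c → c ≤ b → ¬ b ≤ c → T (U a c))
      → ∀ {x y} → T (U x y) → ¬ T (rlp a b x y) → T (U a b)
    ∉rlp⇒∋ab {U} a≤b tsU ac∈U {x} {y} xy∈U xy∉rlp =
      ts-trans tsU (ac∈U a≤x∧b (x∧y≤y _ _) b≰x∧b) x∧b,b∈U
      where
      obstruction : a ≤ x × b ≤ y × ¬ b ≤ x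
      obstruction = ¬rlp⇒a≤x×b≤y×b≰x (ts-sub tsU xy∈U) xy∉rlp

      a≤x∧b : a ≤ (x ⊓ b)
      a≤x∧b = ∧-greatest (proj₁ obstruction) a≤b

      b≰x∧b : ¬ b ≤ (x ⊓ b)
      b≰x∧b b≤x∧b = proj₂ (proj₂ obstruction) (≤-trans b≤x∧b (x∧y≤x _ _))

      x∧b,b∈U : T (U (x ⊓ b) b)
      x∧b,b∈U = ts-restrict tsU b xy∈U (proj₁ (proj₂ obstruction))

    rlp*-isTransferSystem : IsTransferSystem L (rlp* a b)
    rlp*-isTransferSystem = record
      { subposet = record
        { sub   = λ _ _ → proj₁ ∘ toWitness
        ; refl  = λ _ → fromWitness (≤-refl , λ _ b≤x → inj₁ b≤x)
        ; trans = λ _ _ _ m₁ m₂ → let x≤y , xy = toWitness m₁ ; y≤z , yz = toWitness m₂ in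
            fromWitness (≤-trans x≤y y≤z , λ a≤x b≤z →
              [ xy a≤x , (λ y≤a → inj₂ (≤-trans x≤y y≤a)) ] (yz (≤-trans a≤x x≤y) b≤z))
        }
      ; restrict = λ _ _ _ m w≤y → let _ , xy = toWitness m in
          fromWitness (x∧y≤y _ _ , λ a≤x∧w b≤w →
            Sum.map (λ b≤x → ∧-greatest b≤x b≤w) (≤-trans (x∧y≤x _ _))
              (xy (≤-trans a≤x∧w (x∧y≤x _ _)) (≤-trans b≤w w≤y)))
      }

    idOrBelow-isTransferSystem : IsTransferSystem L (idOrBelow a b)
    idOrBelow-isTransferSystem = record
      { subposet = record
        { sub   = λ _ _ → proj₁ ∘ toWitness
        ; refl  = λ _ → fromWitness (≤-refl , inj₁ ≤-refl)
        ; trans = λ _ _ _ i₁ i₂ → let x≤y , xy = toWitness i₁ ; y≤z , yz = toWitness i₂ in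
            fromWitness (≤-trans x≤y y≤z , compose x≤y xy yz)
        }
      ; restrict = λ _ _ _ i w≤y → let _ , xy = toWitness i in
          fromWitness (x∧y≤y _ _ , Sum.map (λ y≤x → ∧-greatest (≤-trans w≤y y≤x) ≤-refl)
                                           (Product.map (≤-trans (x∧y≤x _ _)) (≤-trans w≤y)) xy)
      }
      where
      compose : ∀ {x y z} → x ≤ y → y ≤ x ⊎ x ≤ a × y ≤ b → z ≤ y ⊎ y ≤ a × z ≤ b
        → z ≤ x ⊎ x ≤ a × z ≤ b
      compose _   (inj₁ y≤x)         (inj₁ z≤y)         = inj₁ (≤-trans z≤y y≤x)
      compose x≤y (inj₁ _)           (inj₂ (y≤a , z≤b)) = inj₂ (≤-trans x≤y y≤a , z≤b)
      compose _   (inj₂ (x≤a , y≤b)) (inj₁ z≤y)         = inj₂ (x≤a , ≤-trans z≤y y≤b)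
      compose _   (inj₂ (x≤a , _))   (inj₂ (_ , z≤b))   = inj₂ (x≤a , z≤b)

    ab∈rlp* : a ≤ b → T (rlp* a b a b)
    ab∈rlp* a≤b = fromWitness (a≤b , λ _ _ → inj₂ ≤-refl)

    rlp⊆rlp* : rlp a b ⊆ rlp* a b
    rlp⊆rlp* _ _ m = let x≤y , xy = toWitness m in fromWitness (x≤y , λ a≤x b≤y → inj₁ (xy a≤x b≤y))

    rlp*⇒rlp⊎x≤a×b≤y : ∀ {x y} → T (rlp* a b x y) → T (rlp a b x y) ⊎ x ≤ a × b ≤ y
    rlp*⇒rlp⊎x≤a×b≤y m* = let x≤y , xy = toWitness m* in
      Sum.map₁ (λ lifts → fromWitness (x≤y , lifts)) (liftsOrBelow xy)
      where
      liftsOrBelow : ∀ {x y} → (a ≤ x → b ≤ y → b ≤ x ⊎ x ≤ a)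
        → LiftsLeft L a b x y ⊎ x ≤ a × b ≤ y
      liftsOrBelow {x} {y} xy with a ≤? x | b ≤? y
      ... | no a≰x  | _       = inj₁ λ a≤x → ⊥-elim (a≰x a≤x)
      ... | yes _   | no b≰y  = inj₁ λ _ b≤y → ⊥-elim (b≰y b≤y)
      ... | yes a≤x | yes b≤y = Sum.map (λ b≤x _ _ → b≤x) (_, b≤y) (xy a≤x b≤y)

    rlp*-least : ∀ {U} → ¬ b ≤ a → IsTransferSystem L U → rlp a b ⊆ U → T (U a b) → rlp* a b ⊆ U
    rlp*-least {U} b≰a tsU rlp⊆U ab∈U x y m* with rlp*⇒rlp⊎x≤a×b≤y m*
    ... | inj₁ m             = rlp⊆U x y m
    ... | inj₂ (x≤a , b≤y) = ts-trans tsU (ts-trans tsU xa∈U ab∈U) by∈U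
      where
      xa∈U : T (U x a)
      xa∈U = rlp⊆U _ _ (b≰y⇒rlp x≤a b≰a)

      by∈U : T (U b y)
      by∈U = rlp⊆U _ _ (b≤x⇒rlp b≤y ≤-refl)

    module _ (a<b : _<L_ L a b) where
      private
        a≤b : a ≤ b
        a≤b = proj₁ a<b

        b≰a : ¬ b ≤ a
        b≰a b≤a = proj₂ a<b (antisym a≤b b≤a)

      ab∉rlp : ¬ T (rlp a b a b)
      ab∉rlp m = b≰a (proj₂ (toWitness m) ≤-refl ≤-refl)

      rlp-uniqueUpperCover : UniqueUpperCover L (rlp a b) (rlp* a b)
      rlp-uniqueUpperCover = uniqueUpperCover-intro (rlp-isTransferSystem a b) rlp*-isTransferSystem
        (rlp⊆rlp* , λ rlp*⊆rlp → ab∉rlp (rlp*⊆rlp a b (ab∈rlp* a≤b)))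
        above
        where
        above : ∀ U → IsTransferSystem L U → rlp a b ⊂ U → rlp* a b ⊆ U
        above U tsU (rlp⊆U , U⊈rlp) = rlp*-least b≰a tsU rlp⊆U ab∈U
          where
          ac∈U : ∀ {c} → a ≤ c → c ≤ b → ¬ b ≤ c → T (U a c)
          ac∈U a≤c _ b≰c = rlp⊆U _ _ (b≰y⇒rlp a≤c b≰c)

          ab∈U : T (U a b)
          ab∈U = decidable-stable (T? (U a b)) λ ab∉U → U⊈rlp λ x y u →
            decidable-stable (T? (rlp a b x y)) λ xy∉rlp → ab∉U (∉rlp⇒∋ab a≤b tsU ac∈U u xy∉rlp)

      module _ {J : BRel L} (trJ : IsTr L a b J) where
        private
          tsJ : IsTransferSystem L J
          tsJ = proj₁ trJ

          ab∈J : T (J a b)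
          ab∈J = proj₁ (proj₂ trJ)

          J⊆ : ∀ U → IsTransferSystem L U → T (U a b) → J ⊆ U
          J⊆ = proj₂ (proj₂ trJ)

        tr⊆idOrBelow : J ⊆ idOrBelow a b
        tr⊆idOrBelow =
          J⊆ (idOrBelow a b) idOrBelow-isTransferSystem (fromWitness (a≤b , inj₂ (≤-refl , ≤-refl)))

        tr∖rlp⇒≡ab : ∀ {x y} → T (J x y) → ¬ T (rlp a b x y) → x ≡ a × y ≡ b
        tr∖rlp⇒≡ab {x} {y} xy∈J xy∉rlp with toWitness (tr⊆idOrBelow x y xy∈J)
        ... | x≤y , below with ¬rlp⇒a≤x×b≤y×b≰x x≤y xy∉rlp | below
        ... | _ , b≤y , b≰x | inj₁ y≤x         = ⊥-elim (b≰x (≤-trans b≤y y≤x))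
        ... | a≤x , b≤y , _ | inj₂ (x≤a , y≤b) = antisym x≤a a≤x , antisym y≤b b≤y

        tr∋ac : ∀ {c} → a ≤ c → c ≤ b → T (J a c)
        tr∋ac {c} a≤c c≤b = subst (λ z → T (J z c)) (x≤y⇒x∧y≡x a≤c) (ts-restrict tsJ c ab∈J c≤b)

        tr∩rlp-uniqueLowerCover : UniqueLowerCover L J (J ∩ rlp a b)
        tr∩rlp-uniqueLowerCover = uniqueLowerCover-intro tsJ (∩-isTransferSystem tsJ (rlp-isTransferSystem a b))
          (∩-⊆ˡ J (rlp a b) , λ J⊆J∩rlp → ab∉rlp (proj₂ (∋-∩⁻ J (rlp a b) (J⊆J∩rlp a b ab∈J))))
          below
          where
          below : ∀ U → IsTransferSystem L U → U ⊂ J → U ⊆ J ∩ rlp a b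
          below U tsU (U⊆J , J⊈U) x y xy∈U = ∋-∩⁺ J (rlp a b) (U⊆J x y xy∈U)
            (decidable-stable (T? (rlp a b x y)) λ xy∉rlp →
              J⊈U (J⊆ U tsU (ab∈U (tr∖rlp⇒≡ab (U⊆J x y xy∈U) xy∉rlp))))
            where
            ab∈U : x ≡ a × y ≡ b → T (U a b)
            ab∈U (refl , refl) = xy∈U

        rlp-isKappa : IsKappa L J (rlp a b)
        rlp-isKappa = rlp-isTransferSystem a b , J ∩ rlp a b , tr∩rlp-uniqueLowerCover
                    , rlp* a b , rlp-uniqueUpperCover
                    , ((λ _ _ → id) , (λ _ _ → id))
                    , (∩-⊆ˡ J (rlp* a b) , λ x y xy∈J → ∋-∩⁺ J (rlp* a b) xy∈J (J⊆rlp* x y xy∈J))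
          where
          J⊆rlp* : J ⊆ rlp* a b
          J⊆rlp* = J⊆ (rlp* a b) rlp*-isTransferSystem (ab∈rlp* a≤b)

        isKappa⇒≐rlp : ∀ {M} → IsKappa L J M → M ≐ rlp a b
        isKappa⇒≐rlp {M} (tsM , J* , J*-lowerCover , M* , M*-upperCover , J∩M≐J* , J∩M*≐J) =
          M⊆rlp , rlp⊆M
          where
          J∩rlp≐J* : J ∩ rlp a b ≐ J*
          J∩rlp≐J* = proj₂ J*-lowerCover (J ∩ rlp a b) (proj₁ tr∩rlp-uniqueLowerCover)

          ab∉M : ¬ T (M a b)
          ab∉M ab∈M = ab∉rlp (proj₂ (∋-∩⁻ J (rlp a b)
            (proj₂ J∩rlp≐J* a b (proj₁ J∩M≐J* a b (∋-∩⁺ J M ab∈J ab∈M)))))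

          ac∈M : ∀ {c} → a ≤ c → c ≤ b → ¬ b ≤ c → T (M a c)
          ac∈M a≤c c≤b b≰c = proj₂ (∋-∩⁻ J M (proj₂ J∩M≐J* _ _ (proj₁ J∩rlp≐J* _ _
            (∋-∩⁺ J (rlp a b) (tr∋ac a≤c c≤b) (b≰y⇒rlp a≤c b≰c)))))

          M⊆rlp : M ⊆ rlp a b
          M⊆rlp x y xy∈M = decidable-stable (T? (rlp a b x y)) λ xy∉rlp →
            ab∉M (∉rlp⇒∋ab a≤b tsM ac∈M xy∈M xy∉rlp)

          rlp⊆M : rlp a b ⊆ M
          rlp⊆M x y xy∈rlp = decidable-stable (T? (M x y)) λ xy∉M →
            ab∉rlp (uniqueUpperCover-least M*-upperCover (rlp a b) (rlp-isTransferSystem a b)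
              (M⊆rlp , λ rlp⊆M → xy∉M (rlp⊆M x y xy∈rlp)) a b ab∈M*)
            where
            ab∈M* : T (M* a b)
            ab∈M* = proj₂ (∋-∩⁻ J M* (proj₂ J∩M*≐J a b ab∈J))

mainTheorem17 : (L : FinLattice) → (a b : Carrier L) → _<L_ L a b
    → (J : BRel L) → IsTr L a b J
    → (S : BRel L) → IsLs L a b S
    → Σ (BRel L) (λ M → IsKappa L J M)
      × ((M : BRel L) → IsKappa L J M → (x y : Carrier L)
          → ((_∋_,_ L M x y ⇔ (FinLattice._≤_ L x y × ((u v : Carrier L) → _∋_,_ L S u v → LiftsLeft L u v x y)))
            × (_∋_,_ L M x y ⇔ (FinLattice._≤_ L x y × LiftsLeft L a b x y))))
mainTheorem17 L a b a<b J trJ S lsS =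
  (rlp L a b , rlp-isKappa L a<b trJ) , λ M κ x y →
    let M⇔rlp = ∋-rlp L ⇔-∘ ≐⇒∋⇔ L (isKappa⇒≐rlp L a<b trJ κ) in
    (⇔-id _ ×-⇔ ls-liftsLeft L lsS) ⇔-∘ M⇔rlp , M⇔rlp
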